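{- For all $n\ge 3$, $$\beta(P_\infty\Box C_n)=\begin{cases}2 & \text{if } n \text{ is odd},\\ 3 & \text{if } n \text{ is even},\end{cases}$$ and $S_1=\{(0,0),(0,\tfrac{n-1}{2})\}$ is a metric basis if $n$ is odd, and $S_2=\{(0,0),(0,\tfrac n2),(0,1)\}$ is a metric basis if $n$ is even.
   Context: $P_\infty$ has vertex set $\mathbb{N}=\{0,1,2,\dots\}$ with $i,j$ adjacent iff $|i-j|=1$. $C_n$ has vertex set $\{0,1,\dots,n-1\}$ with $0\le i\le j\le n-1$ adjacent iff $j-i=1$ or $j-i=n-1$. The cartesian product $G\Box H$ has vertex set $V(G)\times V(H)$, with $(a,v)$ adjacent to $(b,w)$ iff either $a=b$ and $vw\in E(H)$, or $v=w$ and $ab\in E(G)$. $d$ is the shortest-path distance. A vertex $x$ resolves $u,v$ if $d(u,x)\neq d(v,x)$; a set $S$ is a resolving set if every pair of distinct vertices is resolved by some vertex of $S$; a metric basis is a resolving set of minimum cardinality and $\beta$ (metric dimension) is its cardinality (infinite if no finite resolving set exists). -}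

module Defs where

open import Data.Nat using (ℕ; zero; suc; _≤_; _∸_)
open import Data.Fin using (Fin; toℕ)
open import Data.Product using (_×_; Σ; ∃-syntax; _,_)
open import Data.Sum using (_⊎_)
open import Data.List using (List; length)
open import Data.List.Membership.Propositional using (_∈_)
open import Data.List.Relation.Unary.Any using (Any)
open import Data.List.Relation.Unary.Unique.Propositional using (Unique)
open import Relation.Binary.PropositionalEquality using (_≡_; _≢_)

PAdj : ℕ → ℕ → Set
PAdj i j = j ≡ suc i ⊎ i ≡ suc j

CAdj : (n : ℕ) → Fin n → Fin n → Set
CAdj n i j =
  (toℕ j ≡ suc (toℕ i)) ⊎ (toℕ i ≡ suc (toℕ j)) ⊎
  (toℕ i ≡ 0 × toℕ j ≡ n ∸ 1) ⊎ (toℕ j ≡ 0 × toℕ i ≡ n ∸ 1)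

V : ℕ → Set
V n = ℕ × Fin n

Adj : (n : ℕ) → V n → V n → Set
Adj n (a , v) (b , w) = (a ≡ b × CAdj n v w) ⊎ (v ≡ w × PAdj a b)

data Walk (n : ℕ) : V n → V n → ℕ → Set where
  nil  : ∀ {u} → Walk n u u 0
  cons : ∀ {u v w k} → Adj n u v → Walk n v w k → Walk n u w (suc k)

Dist : (n : ℕ) → V n → V n → ℕ → Set
Dist n u v k = Walk n u v k × (∀ m → Walk n u v m → k ≤ m)

Resolves : (n : ℕ) → V n → V n → V n → Set
Resolves n x u v = Σ ℕ λ k → Σ ℕ λ l → Dist n u x k × Dist n v x l × k ≢ l

Resolving : (n : ℕ) → List (V n) → Set
Resolving n S = ∀ (u v : V n) → u ≢ v → ∃[ x ] (x ∈ S × Resolves n x u v)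

IsMetricBasis : (n : ℕ) → List (V n) → Set
IsMetricBasis n S =
  Unique S × Resolving n S ×
  (∀ (T : List (V n)) → Unique T → Resolving n T → length S ≤ length T)

MetricDim : (n : ℕ) → ℕ → Set
MetricDim n m = ∃[ S ] (IsMetricBasis n S × length S ≡ m)

module Submission where

-- The distance of the product is explicit, d((a , i) , (b , t)) = |a - b| + cyc n |i - t|
-- with cyc n e = min(e , n - e).  It is verified through a general criterion
-- (DistanceCriterion): a function vanishing exactly at x, growing by at most one
-- along edges and dropping by one along some edge at every other vertex is the
-- distance to x.
-- Upper bounds: the distances of (p , V) to (0 , 0) and (0 , k) add up to 2p plus a
-- constant depending only on the arc of V (k on [0 , k], n - k beyond).  For n = 2k + 1
-- the parity of the sum reveals the arc, hence p and V; for n = 2k it gives p and V up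
-- to the reflection V ↦ n - V, which the landmark (0 , 1) removes.
-- Lower bounds: a landmark has its layer neighbour and its cycle neighbours at distance
-- one, so one landmark never suffices.  For n = 2k the cycle is bipartite, so both
-- neighbours of a vertex at distance k from p are at distance k - 1 from p; this gives,
-- for every pair of landmarks, two distinct vertices they do not separate.

open import Defs
open import Data.Nat using (ℕ; zero; suc; pred; _<?_; _≤?_; _≟_; _+_; _*_; _≤_; _<_; _∸_; _/_; _%_; _⊓_; ∣_-_∣; z≤n; s≤s; s≤s⁻¹)
open import Data.Nat.Properties
open import Data.Nat.DivMod using (m≡m%n+[m/n]*n; m*n/n≡m)
open import Data.Nat.Tactic.RingSolver using (solve-∀)
open import Data.Fin using (Fin; toℕ; fromℕ<)
open import Data.Fin.Properties using (toℕ-injective; toℕ<n; toℕ-fromℕ<)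
open import Data.Product using (_×_; _,_; Σ; proj₁; proj₂)
open import Data.Sum using (_⊎_; inj₁; inj₂; swap)
open import Data.Empty using (⊥; ⊥-elim)
open import Data.List using (List; _∷_; []; length)
open import Data.List.Membership.Propositional using (find)
open import Data.List.Relation.Unary.All using (All; []; _∷_; all?; lookup)
open import Data.List.Relation.Unary.All.Properties using (¬All⇒Any¬)
import Data.List.Relation.Unary.AllPairs as AllPairs
open import Function using (_∘_)
open import Relation.Nullary using (¬_; yes; no; contradiction)
open import Relation.Binary using (tri<; tri≈; tri>)
open import Relation.Binary.PropositionalEquality using (_≡_; _≢_; refl; sym; trans; cong; cong₂; subst; subst₂; module ≡-Reasoning)

-- The shorter way round the n-cycle: the cyclic length of an offset d ≤ n.
cyc : ℕ → ℕ → ℕ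
cyc n d = d ⊓ (n ∸ d)

cyc-short : ∀ n d → d + d ≤ n → cyc n d ≡ d
cyc-short n d short = m≤n⇒m⊓n≡m (m+n≤o⇒m≤o∸n d short)

cyc-long : ∀ n d → n ≤ d + d → cyc n d ≡ n ∸ d
cyc-long n d long = m≥n⇒m⊓n≡n (m≤n+o⇒m∸n≤o n d long)

cyc-reflect : ∀ n d → d ≤ n → cyc n (n ∸ d) ≡ cyc n d
cyc-reflect n d d≤n rewrite m∸[m∸n]≡n d≤n = ⊓-comm (n ∸ d) d

cyc-zero : ∀ n d → d < n → cyc n d ≡ 0 → d ≡ 0
cyc-zero n d d<n e with ⊓-sel d (n ∸ d)
... | inj₁ e' = trans (sym e') e
... | inj₂ e' = contradiction (m∸n≡0⇒m≤n (trans (sym e') e)) (<⇒≱ d<n)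

cyc-step : ∀ n x y → y ≤ n → x ≡ suc y ⊎ y ≡ suc x → cyc n x ≤ suc (cyc n y)
cyc-step n .(suc y) y _ (inj₁ refl) =
  ⊓-mono-≤ {suc y} ≤-refl (≤-trans (∸-monoʳ-≤ n (n≤1+n y)) (n≤1+n _))
cyc-step n x .(suc x) sx≤n (inj₂ refl) =
  ⊓-mono-≤ {x} (≤-trans (n≤1+n x) (n≤1+n _)) (≤-reflexive (+-∸-assoc 1 sx≤n))

cyc-pred-short : ∀ n d k → suc d + suc d ≤ n → cyc n (suc d) ≡ suc k → cyc n d ≡ k
cyc-pred-short n d k short e =
  trans (cyc-short n d (≤-trans (+-mono-≤ (n≤1+n d) (n≤1+n d)) short))
        (suc-injective (trans (sym (cyc-short n (suc d) short)) e))

cyc-succ-long : ∀ n d k → n ≤ d + d → cyc n d ≡ suc k → cyc n (suc d) ≡ k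
cyc-succ-long n d k long e = begin
  cyc n (suc d)  ≡⟨ cyc-long n (suc d) (≤-trans long (+-mono-≤ (n≤1+n d) (n≤1+n d))) ⟩
  n ∸ suc d      ≡⟨ sym (pred[m∸n]≡m∸[1+n] n d) ⟩
  pred (n ∸ d)   ≡⟨ cong pred (trans (sym (cyc-long n d long)) e) ⟩
  k              ∎
  where open ≡-Reasoning

cyc-≤-half : ∀ n k d → n ≡ k + k → cyc n d ≤ k
cyc-≤-half n k d n≡2k with d ≤? k
... | yes d≤k = ≤-trans (m⊓n≤m d (n ∸ d)) d≤k
... | no d≰k = ≤-trans (m⊓n≤n d (n ∸ d))
  (m≤n+o⇒m∸n≤o n d (subst (_≤ d + k) (sym n≡2k) (+-monoˡ-≤ k (<⇒≤ (≰⇒> d≰k)))))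

∣-∣-toward : ∀ {i t} → i < t → ∣ i - t ∣ ≡ suc ∣ suc i - t ∣
∣-∣-toward {zero} {suc t} _ = refl
∣-∣-toward {suc i} {suc t} (s≤s i<t) = ∣-∣-toward i<t

∣-∣-away : ∀ {i t} → t ≤ i → ∣ suc i - t ∣ ≡ suc ∣ i - t ∣
∣-∣-away {i} {zero} _ = cong suc (sym (∣-∣-identityʳ i))
∣-∣-away {suc i} {suc t} (s≤s t≤i) = ∣-∣-away t≤i

∣-∣-step : ∀ i t → ∣ suc i - t ∣ ≡ suc ∣ i - t ∣ ⊎ ∣ i - t ∣ ≡ suc ∣ suc i - t ∣
∣-∣-step i t with i <? t
... | yes i<t = inj₂ (∣-∣-toward i<t)
... | no i≮t = inj₁ (∣-∣-away (≮⇒≥ i≮t))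

∣-∣-< : ∀ {n} i t → i < n → t < n → ∣ i - t ∣ < n
∣-∣-< i t i<n t<n = ≤-<-trans (∣m-n∣≤m⊔n i t) (⊔-lub i<n t<n)

-- The top position n - 1 is one step below 0 around the cycle.
cyc-wrap : ∀ n t → t < n → cyc n ∣ (n ∸ 1) - t ∣ ≡ cyc n (suc t)
cyc-wrap (suc n) t (s≤s t≤n) =
  trans (cong (cyc (suc n)) (m≤n⇒∣n-m∣≡n∸m t≤n)) (cyc-reflect (suc n) (suc t) (s≤s t≤n))

-- Adjacency of C_n read on positions; CAdj n i j unfolds to CAdjℕ n (toℕ i) (toℕ j).
CAdjℕ : ℕ → ℕ → ℕ → Set
CAdjℕ n I J = (J ≡ suc I) ⊎ (I ≡ suc J) ⊎ (I ≡ 0 × J ≡ n ∸ 1) ⊎ (J ≡ 0 × I ≡ n ∸ 1)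

cyc-adj : ∀ n I J T → J < n → T < n → CAdjℕ n I J → cyc n ∣ I - T ∣ ≤ suc (cyc n ∣ J - T ∣)
cyc-adj n I .(suc I) T J<n T<n (inj₁ refl) =
  cyc-step n _ _ (<⇒≤ (∣-∣-< (suc I) T J<n T<n)) (swap (∣-∣-step I T))
cyc-adj n .(suc J) J T J<n T<n (inj₂ (inj₁ refl)) =
  cyc-step n _ _ (<⇒≤ (∣-∣-< J T J<n T<n)) (∣-∣-step J T)
cyc-adj n .0 .(n ∸ 1) T J<n T<n (inj₂ (inj₂ (inj₁ (refl , refl)))) =
  subst (λ c → cyc n T ≤ suc c) (sym (cyc-wrap n T T<n)) (cyc-step n T (suc T) T<n (inj₂ refl))
cyc-adj n .(n ∸ 1) .0 T J<n T<n (inj₂ (inj₂ (inj₂ (refl , refl)))) =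
  subst (_≤ suc (cyc n T)) (sym (cyc-wrap n T T<n)) (cyc-step n (suc T) T (<⇒≤ T<n) (inj₁ refl))

Closer : ℕ → ℕ → ℕ → ℕ → Set
Closer n I T k = Σ ℕ λ J → J < n × CAdjℕ n I J × cyc n ∣ J - T ∣ ≡ k

-- Along the short arc, step from I towards T.
descend-short : ∀ n I T k → I < n → T < n → ∣ I - T ∣ + ∣ I - T ∣ ≤ n →
                cyc n ∣ I - T ∣ ≡ suc k → Closer n I T k
descend-short n I T k I<n T<n short e with <-cmp I T
... | tri≈ _ refl _ = contradiction (trans (cong (cyc n) (sym (∣n-n∣≡0 I))) e) 0≢1+n
... | tri< I<T _ _ = suc I , ≤-<-trans I<T T<n , inj₁ refl ,
  cyc-pred-short n _ k (subst (λ d → d + d ≤ n) (∣-∣-toward I<T) short)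
                       (subst (λ d → cyc n d ≡ suc k) (∣-∣-toward I<T) e)
descend-short n (suc I) T k I<n T<n short e | tri> _ _ (s≤s T≤I) =
  I , <-trans (n<1+n I) I<n , inj₂ (inj₁ refl) ,
  cyc-pred-short n _ k (subst (λ d → d + d ≤ n) (∣-∣-away T≤I) short)
                       (subst (λ d → cyc n d ≡ suc k) (∣-∣-away T≤I) e)

top-long⇒short : ∀ n T → T < n → n ≤ ∣ (n ∸ 1) - T ∣ + ∣ (n ∸ 1) - T ∣ → suc T + suc T ≤ n
top-long⇒short (suc n) T (s≤s T≤n) long = begin
  suc T + suc T        ≤⟨ +-monoʳ-≤ (suc T) sT≤D ⟩
  suc T + (n ∸ T)      ≡⟨ +-comm (suc T) (n ∸ T) ⟩
  (n ∸ T) + suc T      ≡⟨ +-suc (n ∸ T) T ⟩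
  suc ((n ∸ T) + T)    ≡⟨ cong suc (m∸n+n≡m T≤n) ⟩
  suc n                ∎
  where
  open ≤-Reasoning
  D≡ : ∣ n - T ∣ ≡ n ∸ T
  D≡ = m≤n⇒∣n-m∣≡n∸m T≤n
  sT≤D : suc T ≤ n ∸ T
  sT≤D = +-cancelˡ-≤ (n ∸ T) (suc T) (n ∸ T) (begin
    (n ∸ T) + suc T    ≡⟨ +-suc (n ∸ T) T ⟩
    suc ((n ∸ T) + T)  ≡⟨ cong suc (m∸n+n≡m T≤n) ⟩
    suc n              ≤⟨ subst (λ d → suc n ≤ d + d) D≡ long ⟩
    (n ∸ T) + (n ∸ T)  ∎)

-- Along the long arc, step from I away from T (wrapping round if necessary).
descend-long : ∀ n I T k → I < n → T < n → n ≤ ∣ I - T ∣ + ∣ I - T ∣ →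
               cyc n ∣ I - T ∣ ≡ suc k → Closer n I T k
descend-long n I T k I<n T<n long e with <-cmp I T
... | tri≈ _ refl _ = contradiction (trans (cong (cyc n) (sym (∣n-n∣≡0 I))) e) 0≢1+n
descend-long n zero T k I<n T<n long e | tri< _ _ _ =
  n ∸ 1 , ∸-monoʳ-< {n} (s≤s z≤n) I<n , inj₂ (inj₂ (inj₁ (refl , refl))) ,
  trans (cyc-wrap n T T<n) (cyc-succ-long n T k long e)
descend-long n (suc I) T k I<n T<n long e | tri< sI<T _ _ =
  I , <-trans (n<1+n I) I<n , inj₂ (inj₁ refl) ,
  subst (λ d → cyc n d ≡ k) (sym (∣-∣-toward (<-trans (n<1+n I) sI<T))) (cyc-succ-long n _ k long e)
... | tri> _ _ T<I with suc I <? n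
...   | yes sI<n = suc I , sI<n , inj₁ refl ,
  subst (λ d → cyc n d ≡ k) (sym (∣-∣-away (<⇒≤ T<I))) (cyc-succ-long n _ k long e)
...   | no sI≮n = 0 , ≤-<-trans z≤n I<n , inj₂ (inj₂ (inj₂ (refl , I≡top))) ,
  cyc-pred-short n T k (top-long⇒short n T T<n (subst (λ i → n ≤ ∣ i - T ∣ + ∣ i - T ∣) I≡top long))
    (trans (sym (cyc-wrap n T T<n)) (subst (λ i → cyc n ∣ i - T ∣ ≡ suc k) I≡top e))
  where
  I≡top : I ≡ n ∸ 1
  I≡top = cong pred (≤-antisym I<n (≮⇒≥ sI≮n))

cyc-descend : ∀ n I T k → I < n → T < n → cyc n ∣ I - T ∣ ≡ suc k → Closer n I T k
cyc-descend n I T k I<n T<n e with ≤-total (∣ I - T ∣ + ∣ I - T ∣) n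
... | inj₁ short = descend-short n I T k I<n T<n short e
... | inj₂ long = descend-long n I T k I<n T<n long e

cyc-neighbour : ∀ n P J → 2 ≤ n → CAdjℕ n P J → cyc n ∣ J - P ∣ ≡ 1
cyc-neighbour n P .(suc P) 2≤n (inj₁ refl) =
  trans (cong (cyc n) (trans (∣-∣-away {P} ≤-refl) (cong suc (∣n-n∣≡0 P)))) (cyc-short n 1 2≤n)
cyc-neighbour n .(suc J) J 2≤n (inj₂ (inj₁ refl)) =
  trans (cong (cyc n) (trans (∣-∣-toward (n<1+n J)) (cong suc (∣n-n∣≡0 J)))) (cyc-short n 1 2≤n)
cyc-neighbour n .0 .(n ∸ 1) 2≤n (inj₂ (inj₂ (inj₁ (refl , refl)))) =
  trans (cong (cyc n) (∣-∣-identityʳ (n ∸ 1)))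
        (trans (cyc-reflect n 1 (≤-trans (n≤1+n 1) 2≤n)) (cyc-short n 1 2≤n))
cyc-neighbour n .(n ∸ 1) .0 2≤n (inj₂ (inj₂ (inj₂ (refl , refl)))) =
  trans (cyc-reflect n 1 (≤-trans (n≤1+n 1) 2≤n)) (cyc-short n 1 2≤n)

-- Parity, with even numbers written m + m throughout.
Even : ℕ → Set
Even x = Σ ℕ λ m → x ≡ m + m

double : ∀ m → 2 * m ≡ m + m
double m = cong (m +_) (+-identityʳ m)

even≢odd′ : ∀ a b → a + a ≢ suc (b + b)
even≢odd′ a b e = even≢odd a b (trans (double a) (trans e (cong suc (sym (double b)))))

-- The absolute difference and the sum of two numbers have the same parity.
∣-∣+double-min : ∀ i t → ∣ i - t ∣ + ((i ⊓ t) + (i ⊓ t)) ≡ i + t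
∣-∣+double-min zero t = +-identityʳ t
∣-∣+double-min (suc i) zero = cong suc (trans (+-identityʳ i) (sym (+-identityʳ i)))
∣-∣+double-min (suc i) (suc t) = begin
  ∣ i - t ∣ + (suc m + suc m)       ≡⟨ cong (∣ i - t ∣ +_) (cong suc (+-suc m m)) ⟩
  ∣ i - t ∣ + suc (suc (m + m))     ≡⟨ +-suc ∣ i - t ∣ (suc (m + m)) ⟩
  suc (∣ i - t ∣ + suc (m + m))     ≡⟨ cong suc (+-suc ∣ i - t ∣ (m + m)) ⟩
  suc (suc (∣ i - t ∣ + (m + m)))   ≡⟨ cong (λ x → suc (suc x)) (∣-∣+double-min i t) ⟩
  suc (suc (i + t))                 ≡⟨ cong suc (sym (+-suc i t)) ⟩
  suc i + suc t                     ∎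
  where
  open ≡-Reasoning
  m : ℕ
  m = i ⊓ t

cyc-parity : ∀ n k I T → n ≡ k + k → I < n → T < n → Even (cyc n ∣ I - T ∣ + (I + T))
cyc-parity n k I T n≡2k I<n T<n = by-arc (⊓-sel d (n ∸ d))
  where
  open ≡-Reasoning
  d m : ℕ
  d = ∣ I - T ∣
  m = I ⊓ T
  regroup₁ : ∀ d m → d + (d + (m + m)) ≡ (d + m) + (d + m)
  regroup₁ = solve-∀
  regroup₂ : ∀ k m → (k + k) + (m + m) ≡ (k + m) + (k + m)
  regroup₂ = solve-∀
  by-arc : cyc n d ≡ d ⊎ cyc n d ≡ n ∸ d → Even (cyc n d + (I + T))
  by-arc (inj₁ e) = d + m , (begin
    cyc n d + (I + T)        ≡⟨ cong₂ _+_ e (sym (∣-∣+double-min I T)) ⟩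
    d + (d + (m + m))        ≡⟨ regroup₁ d m ⟩
    (d + m) + (d + m)        ∎)
  by-arc (inj₂ e) = k + m , (begin
    cyc n d + (I + T)        ≡⟨ cong₂ _+_ e (sym (∣-∣+double-min I T)) ⟩
    (n ∸ d) + (d + (m + m))  ≡⟨ sym (+-assoc (n ∸ d) d (m + m)) ⟩
    ((n ∸ d) + d) + (m + m)  ≡⟨ cong (_+ (m + m)) (trans (m∸n+n≡m (<⇒≤ (∣-∣-< I T I<n T<n))) n≡2k) ⟩
    (k + k) + (m + m)        ≡⟨ regroup₂ k m ⟩
    (k + m) + (k + m)        ∎)

adjacent-odd-sum : ∀ n k I J → n ≡ k + k → I < n → CAdjℕ n I J → Σ ℕ λ m → I + J ≡ suc (m + m)
adjacent-odd-sum n k I .(suc I) _ _ (inj₁ refl) = I , +-suc I I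
adjacent-odd-sum n k .(suc J) J _ _ (inj₂ (inj₁ refl)) = J , refl
adjacent-odd-sum n (suc k) .0 .(n ∸ 1) n≡2k _ (inj₂ (inj₂ (inj₁ (refl , refl)))) =
  k , trans (cong (_∸ 1) n≡2k) (+-suc k k)
adjacent-odd-sum n (suc k) .(n ∸ 1) .0 n≡2k _ (inj₂ (inj₂ (inj₂ (refl , refl)))) =
  k , trans (+-identityʳ (n ∸ 1)) (trans (cong (_∸ 1) n≡2k) (+-suc k k))
adjacent-odd-sum n zero I J refl () _

cyc-adjacent-differ : ∀ n k I J T → n ≡ k + k → I < n → J < n → T < n → CAdjℕ n I J →
                      cyc n ∣ I - T ∣ ≢ cyc n ∣ J - T ∣
cyc-adjacent-differ n k I J T n≡2k I<n J<n T<n adj same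
  with cyc-parity n k I T n≡2k I<n T<n | cyc-parity n k J T n≡2k J<n T<n
     | adjacent-odd-sum n k I J n≡2k I<n adj
... | a , ea | b , eb | m , em = even≢odd′ (a + b) (c + T + m) (begin
  (a + b) + (a + b)                  ≡⟨ regroup₁ a b ⟩
  (a + a) + (b + b)                  ≡⟨ cong₂ _+_ (sym ea) (trans (sym eb) (cong (_+ (J + T)) (sym same))) ⟩
  (c + (I + T)) + (c + (J + T))      ≡⟨ regroup₂ c I J T ⟩
  ((c + T) + (c + T)) + (I + J)      ≡⟨ cong (((c + T) + (c + T)) +_) em ⟩
  ((c + T) + (c + T)) + suc (m + m)  ≡⟨ regroup₃ (c + T) m ⟩
  suc ((c + T + m) + (c + T + m))    ∎)
  where
  open ≡-Reasoning
  c : ℕ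
  c = cyc n ∣ I - T ∣
  regroup₁ : ∀ a b → (a + b) + (a + b) ≡ (a + a) + (b + b)
  regroup₁ = solve-∀
  regroup₂ : ∀ c I J T → (c + (I + T)) + (c + (J + T)) ≡ ((c + T) + (c + T)) + (I + J)
  regroup₂ = solve-∀
  regroup₃ : ∀ x m → (x + x) + suc (m + m) ≡ suc ((x + m) + (x + m))
  regroup₃ = solve-∀

antipode : ∀ n k T → n ≡ k + k → T < n → Σ ℕ λ Y → Y < n × cyc n ∣ Y - T ∣ ≡ k
antipode n k T n≡2k T<n with T <? k
... | yes T<k = T + k , subst (T + k <_) (sym n≡2k) (+-monoˡ-< k T<k) ,
  trans (cong (cyc n) (trans (∣-∣-comm (T + k) T) (∣m-m+n∣≡n T k)))
        (cyc-short n k (≤-reflexive (sym n≡2k)))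
... | no T≮k = T ∸ k , ≤-<-trans (m∸n≤m T k) T<n ,
  trans (cong (cyc n) (trans (m≤n⇒∣m-n∣≡n∸m (m∸n≤m T k)) (m∸[m∸n]≡n (≮⇒≥ T≮k))))
        (cyc-short n k (≤-reflexive (sym n≡2k)))

two-neighbours : ∀ n P → 3 ≤ n → P < n →
                 Σ ℕ λ J → Σ ℕ λ J' → J < n × J' < n × CAdjℕ n P J × CAdjℕ n P J' × J ≢ J'
two-neighbours n@(suc (suc (suc m))) P (s≤s (s≤s (s≤s z≤n))) P<n with suc P <? n
two-neighbours n@(suc (suc (suc m))) zero (s≤s (s≤s (s≤s z≤n))) P<n | yes 1<n =
  1 , suc (suc m) , 1<n , ≤-refl , inj₁ refl , inj₂ (inj₂ (inj₁ (refl , refl))) , λ ()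
two-neighbours n@(suc (suc (suc m))) (suc P) (s≤s (s≤s (s≤s z≤n))) P<n | yes sP<n =
  suc (suc P) , P , sP<n , <-trans (n<1+n P) P<n , inj₁ refl , inj₂ (inj₁ refl) ,
  λ e → <-irrefl (sym e) (<-trans (n<1+n P) (n<1+n (suc P)))
... | no sP≮n with ≤-antisym (s≤s⁻¹ P<n) (s≤s⁻¹ (≮⇒≥ sP≮n))
...   | refl = 0 , suc m , s≤s z≤n , <-trans (n<1+n (suc m)) P<n ,
  inj₂ (inj₂ (inj₂ (refl , refl))) , inj₂ (inj₁ refl) , λ ()

vertexAt : ∀ {n J} (P : ℕ → Set) → J < n → P J → Σ (Fin n) λ j → P (toℕ j)
vertexAt P J<n pJ = fromℕ< J<n , subst P (sym (toℕ-fromℕ< J<n)) pJ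

cdist : ∀ n → Fin n → Fin n → ℕ
cdist n i t = cyc n ∣ toℕ i - toℕ t ∣

cdist-self : ∀ n i → cdist n i i ≡ 0
cdist-self n i = cong (cyc n) (∣n-n∣≡0 (toℕ i))

cdist-zero : ∀ n i t → cdist n i t ≡ 0 → i ≡ t
cdist-zero n i t e =
  toℕ-injective (∣m-n∣≡0⇒m≡n (cyc-zero n _ (∣-∣-< (toℕ i) (toℕ t) (toℕ<n i) (toℕ<n t)) e))

cdist-adj : ∀ n i j t → CAdj n i j → cdist n i t ≤ suc (cdist n j t)
cdist-adj n i j t = cyc-adj n (toℕ i) (toℕ j) (toℕ t) (toℕ<n j) (toℕ<n t)

cdist-descend : ∀ n i t k → cdist n i t ≡ suc k → Σ (Fin n) λ j → CAdj n i j × cdist n j t ≡ k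
cdist-descend n i t k e with cyc-descend n (toℕ i) (toℕ t) k (toℕ<n i) (toℕ<n t) e
... | J , J<n , closer = vertexAt (λ J → CAdjℕ n (toℕ i) J × cyc n ∣ J - toℕ t ∣ ≡ k) J<n closer

cdist-neighbour : ∀ n p y → 2 ≤ n → CAdj n p y → cdist n y p ≡ 1
cdist-neighbour n p y = cyc-neighbour n (toℕ p) (toℕ y)

antipode-neighbour : ∀ n k y z p → n ≡ k + k → cdist n y p ≡ k → CAdj n y z → suc (cdist n z p) ≡ k
antipode-neighbour n k y z p n≡2k yp adj = ≤-antisym
  (≤∧≢⇒< (cyc-≤-half n k _ n≡2k) (λ zp → differ (trans yp (sym zp))))
  (subst (_≤ suc (cdist n z p)) yp (cdist-adj n y z p adj))
  where
  differ : cdist n y p ≢ cdist n z p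
  differ = cyc-adjacent-differ n k (toℕ y) (toℕ z) (toℕ p) n≡2k (toℕ<n y) (toℕ<n z) (toℕ<n p) adj

cdist-antipode : ∀ n k (p : Fin n) → n ≡ k + k → Σ (Fin n) λ y → cdist n y p ≡ k
cdist-antipode n k p n≡2k with antipode n k (toℕ p) n≡2k (toℕ<n p)
... | Y , Y<n , eY = vertexAt (λ Y → cyc n ∣ Y - toℕ p ∣ ≡ k) Y<n eY

cdist-two-neighbours : ∀ n (p : Fin n) → 3 ≤ n →
                       Σ (Fin n) λ y → Σ (Fin n) λ y' → CAdj n p y × CAdj n p y' × y ≢ y'
cdist-two-neighbours n p 3≤n with two-neighbours n (toℕ p) 3≤n (toℕ<n p)
... | J , J' , J<n , J'<n , adj , adj' , J≢J'
  with vertexAt (λ X → CAdjℕ n (toℕ p) X × X ≡ J) J<n (adj , refl)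
     | vertexAt (λ X → CAdjℕ n (toℕ p) X × X ≡ J') J'<n (adj' , refl)
...  | y , a , eJ | y' , a' , eJ' = y , y' , a , a' , λ y≡y' → J≢J' (trans (sym eJ) (trans (cong toℕ y≡y') eJ'))

module DistanceCriterion {n} (x : V n) (h : V n → ℕ)
  (h-target : h x ≡ 0)
  (h-zero : ∀ u → h u ≡ 0 → u ≡ x)
  (h-lipschitz : ∀ u v → Adj n u v → h u ≤ suc (h v))
  (h-descent : ∀ u k → h u ≡ suc k → Σ (V n) λ v → Adj n u v × h v ≡ k) where

  descending-walk : ∀ k u → h u ≡ k → Walk n u x k
  descending-walk zero u e = subst (λ w → Walk n w x 0) (sym (h-zero u e)) nil
  descending-walk (suc k) u e with h-descent u k e
  ... | v , adj , e' = cons adj (descending-walk k v e')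

  walk-length : ∀ {u m} → Walk n u x m → h u ≤ m
  walk-length nil = ≤-reflexive h-target
  walk-length (cons {u = u} {v = v} adj w) = ≤-trans (h-lipschitz u v adj) (s≤s (walk-length w))

  is-distance : ∀ u → Dist n u x (h u)
  is-distance u = descending-walk (h u) u refl , λ m → walk-length

Dist-unique : ∀ {n u x k l} → Dist n u x k → Dist n u x l → k ≡ l
Dist-unique (walk-k , min-k) (walk-l , min-l) = ≤-antisym (min-k _ walk-l) (min-l _ walk-k)

dist : ∀ n → V n → V n → ℕ
dist n (a , i) (b , t) = ∣ a - b ∣ + cdist n i t

∣-∣-path : ∀ a a' c → PAdj a a' → ∣ a - c ∣ ≤ suc ∣ a' - c ∣
∣-∣-path a .(suc a) c (inj₁ refl) with ∣-∣-step a c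
... | inj₁ e = ≤-trans (n≤1+n _) (≤-trans (≤-reflexive (sym e)) (n≤1+n _))
... | inj₂ e = ≤-reflexive e
∣-∣-path .(suc a') a' c (inj₂ refl) with ∣-∣-step a' c
... | inj₁ e = ≤-reflexive e
... | inj₂ e = ≤-trans (n≤1+n _) (≤-trans (≤-reflexive (sym e)) (n≤1+n _))

dist-zero : ∀ n u x → dist n u x ≡ 0 → u ≡ x
dist-zero n (a , i) (b , t) e =
  cong₂ _,_ (∣m-n∣≡0⇒m≡n (m+n≡0⇒m≡0 ∣ a - b ∣ e)) (cdist-zero n i t (m+n≡0⇒n≡0 ∣ a - b ∣ e))

dist-self : ∀ n x → dist n x x ≡ 0
dist-self n (a , i) = cong₂ _+_ (∣n-n∣≡0 a) (cdist-self n i)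

dist-lipschitz : ∀ n x u v → Adj n u v → dist n u x ≤ suc (dist n v x)
dist-lipschitz n (c , t) (a , i) (.a , j) (inj₁ (refl , adj)) =
  ≤-trans (+-monoʳ-≤ ∣ a - c ∣ (cdist-adj n i j t adj)) (≤-reflexive (+-suc ∣ a - c ∣ (cdist n j t)))
dist-lipschitz n (c , t) (a , i) (b , .i) (inj₂ (refl , adj)) =
  +-monoˡ-≤ (cdist n i t) (∣-∣-path a b c adj)

-- Descend in the cycle while possible, then move layer by layer towards x.
dist-descent : ∀ n x u k → dist n u x ≡ suc k → Σ (V n) λ v → Adj n u v × dist n v x ≡ k
dist-descent n (c , t) (a , i) k e with cdist n i t in et
... | suc m with cdist-descend n i t m et
...   | j , adj , ej = (a , j) , inj₁ (refl , adj) ,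
  trans (cong (∣ a - c ∣ +_) ej) (suc-injective (trans (sym (+-suc ∣ a - c ∣ m)) e))
dist-descent n (c , t) (a , i) k e | zero with <-cmp a c
... | tri≈ _ refl _ = contradiction (trans (sym (cong (_+ 0) (∣n-n∣≡0 a))) e) 0≢1+n
... | tri< a<c _ _ = (suc a , i) , inj₂ (refl , inj₁ refl) ,
  trans (cong (∣ suc a - c ∣ +_) et)
        (suc-injective (trans (sym (cong (_+ 0) (∣-∣-toward a<c))) e))
dist-descent n (c , t) (suc a , i) k e | zero | tri> _ _ (s≤s c≤a) = (a , i) , inj₂ (refl , inj₂ refl) ,
  trans (cong (∣ a - c ∣ +_) et)
        (suc-injective (trans (sym (cong (_+ 0) (∣-∣-away c≤a))) e))

dist-is-distance : ∀ n u x → Dist n u x (dist n u x)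
dist-is-distance n u x = is-distance u
  where open DistanceCriterion x (λ u → dist n u x) (dist-self n x) (λ u → dist-zero n u x)
                               (dist-lipschitz n x) (dist-descent n x)

Dist⇒dist : ∀ {n u x k} → Dist n u x k → k ≡ dist n u x
Dist⇒dist {n} {u} {x} d = Dist-unique d (dist-is-distance n u x)

resolves-intro : ∀ n x u v → dist n u x ≢ dist n v x → Resolves n x u v
resolves-intro n x u v differ = dist n u x , dist n v x , dist-is-distance n u x , dist-is-distance n v x , differ

resolves-elim : ∀ n x u v → Resolves n x u v → dist n u x ≢ dist n v x
resolves-elim n x u v (k , l , du , dv , k≢l) same = k≢l (trans (Dist⇒dist du) (trans same (sym (Dist⇒dist dv))))

unresolved : ∀ n (S : List (V n)) u u' → u ≢ u' → All (λ x → dist n u x ≡ dist n u' x) S → ¬ Resolving n S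
unresolved n S u u' u≢u' same resolving with resolving u u' u≢u'
... | x , x∈S , r = resolves-elim n x u u' r (lookup same x∈S)

resolving-by-distances : ∀ n (S : List (V n)) →
  (∀ u w → All (λ x → dist n u x ≡ dist n w x) S → u ≡ w) → Resolving n S
resolving-by-distances n S determined u w u≢w with all? (λ x → dist n u x ≟ dist n w x) S
... | yes same = contradiction (determined u w same) u≢w
... | no ¬same with find (¬All⇒Any¬ (λ x → dist n u x ≟ dist n w x) S ¬same)
...   | x , x∈S , differ = x , x∈S , resolves-intro n x u w differ

cdist-sym : ∀ n i t → cdist n i t ≡ cdist n t i
cdist-sym n i t = cong (cyc n) (∣-∣-comm (toℕ i) (toℕ t))

layer-trade : ∀ A a c c' → a ≤ A → c ≡ suc c' → ∣ A - a ∣ + c ≡ ∣ suc A - a ∣ + c'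
layer-trade A a c c' a≤A refl = trans (+-suc ∣ A - a ∣ c') (cong (_+ c') (sym (∣-∣-away a≤A)))

-- Every resolving set (n ≥ 3) has at least two landmarks: the layer above a landmark
-- and its cycle neighbours are all at distance one from it.
two-landmarks-needed : ∀ n → 3 ≤ n → (T : List (V n)) → Resolving n T → 2 ≤ length T
two-landmarks-needed n 3≤n [] resolving =
  contradiction resolving (unresolved n [] (0 , o) (1 , o) (λ e → 0≢1+n (cong proj₁ e)) [])
  where
  o : Fin n
  o = fromℕ< (≤-trans (s≤s z≤n) 3≤n)
two-landmarks-needed n 3≤n ((b , w) ∷ []) resolving with cdist-two-neighbours n w 3≤n
... | y , _ , adj , _ , _ = contradiction resolving
  (unresolved n _ (b , y) (suc b , w) (λ e → 1+n≢n (sym (cong proj₁ e))) (trans cycle-step (sym layer-step) ∷ []))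
  where
  cycle-step : dist n (b , y) (b , w) ≡ 1
  cycle-step = cong₂ _+_ (∣n-n∣≡0 b) (cdist-neighbour n w y (≤-trans (n≤1+n 2) 3≤n) adj)
  layer-step : dist n (suc b , w) (b , w) ≡ 1
  layer-step = cong₂ _+_ (trans (∣-∣-away {b} ≤-refl) (cong suc (∣n-n∣≡0 b))) (cdist-self n w)
two-landmarks-needed n 3≤n (_ ∷ _ ∷ _) resolving = s≤s (s≤s z≤n)

module EvenCycleLandmarkPairs (n k : ℕ) (n≡2k : n ≡ k + k) (3≤n : 3 ≤ n) where

  -- Antipodal landmarks: the two cycle neighbours of p in layer 0 are not separated.
  antipodal-pair : ∀ a₁ p a₂ q → cdist n p q ≡ k → ¬ Resolving n ((a₁ , p) ∷ (a₂ , q) ∷ [])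
  antipodal-pair a₁ p a₂ q pq with cdist-two-neighbours n p 3≤n
  ... | y , y' , adj , adj' , y≢y' =
    unresolved n _ (0 , y) (0 , y') (λ e → y≢y' (cong proj₂ e))
      (cong (a₁ +_) (trans (near y adj) (sym (near y' adj'))) ∷
       cong (a₂ +_) (suc-injective (trans (far y adj) (sym (far y' adj')))) ∷ [])
    where
    near : ∀ z → CAdj n p z → cdist n z p ≡ 1
    near z = cdist-neighbour n p z (≤-trans (n≤1+n 2) 3≤n)
    far : ∀ z → CAdj n p z → suc (cdist n z q) ≡ k
    far z = antipode-neighbour n k p z q n≡2k pq

  -- Otherwise: y antipodal to p and its neighbour z one step closer to q give the
  -- unseparated vertices (A , y) and (A + 1 , z), A = a₁ + a₂.
  general-pair : ∀ a₁ p a₂ q → cdist n p q ≢ k → ¬ Resolving n ((a₁ , p) ∷ (a₂ , q) ∷ [])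
  general-pair a₁ p a₂ q ¬pq with cdist-antipode n k p n≡2k
  ... | y , yp with cdist n y q in yq
  ...   | zero = contradiction (trans (cdist-sym n p q) (subst (λ v → cdist n v p ≡ k) y≡q yp)) ¬pq
    where
    y≡q : y ≡ q
    y≡q = cdist-zero n y q yq
  ...   | suc m with cdist-descend n y q m yq
  ...     | z , adj , zq =
    unresolved n _ (A , y) (suc A , z) (λ e → 1+n≢n (sym (cong proj₁ e)))
      (layer-trade A a₁ _ _ (m≤m+n a₁ a₂) (trans yp (sym (antipode-neighbour n k y z p n≡2k yp adj))) ∷
       layer-trade A a₂ _ _ (m≤n+m a₂ a₁) (trans yq (cong suc (sym zq))) ∷ [])
    where
    A : ℕ
    A = a₁ + a₂

  no-landmark-pair : ∀ x₁ x₂ → ¬ Resolving n (x₁ ∷ x₂ ∷ [])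
  no-landmark-pair (a₁ , p) (a₂ , q) with cdist n p q ≟ k
  ... | yes pq = antipodal-pair a₁ p a₂ q pq
  ... | no ¬pq = general-pair a₁ p a₂ q ¬pq

three-landmarks-needed : ∀ n k → n ≡ k + k → 3 ≤ n → (T : List (V n)) → Resolving n T → 3 ≤ length T
three-landmarks-needed n k n≡2k 3≤n [] resolving with two-landmarks-needed n 3≤n [] resolving
... | ()
three-landmarks-needed n k n≡2k 3≤n (x ∷ []) resolving with two-landmarks-needed n 3≤n (x ∷ []) resolving
... | s≤s ()
three-landmarks-needed n k n≡2k 3≤n (x₁ ∷ x₂ ∷ []) resolving =
  contradiction resolving (EvenCycleLandmarkPairs.no-landmark-pair n k n≡2k 3≤n x₁ x₂)
three-landmarks-needed n k n≡2k 3≤n (_ ∷ _ ∷ _ ∷ _) resolving = s≤s (s≤s (s≤s z≤n))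

-- Where a position V lies relative to the landmark k, for k + k ≤ n ≤ k + k + 1:
-- on the arc [0 , k], or beyond it (where the cycle distance to 0 is n - V).
data Arc (n k V : ℕ) : Set where
  near : cyc n V ≡ V → cyc n V + cyc n ∣ V - k ∣ ≡ k → Arc n k V
  far  : k < V → cyc n V + V ≡ n → cyc n V + cyc n ∣ V - k ∣ ≡ n ∸ k → Arc n k V

arc : ∀ n k V → k + k ≤ n → n ≤ suc (k + k) → V < n → Arc n k V
arc n k V lo hi V<n with V ≤? k
... | yes V≤k = near cyc-V (begin
  cyc n V + cyc n ∣ V - k ∣  ≡⟨ cong₂ _+_ cyc-V (trans (cong (cyc n) (m≤n⇒∣m-n∣≡n∸m V≤k)) cyc-rest) ⟩
  V + (k ∸ V)                ≡⟨ m+[n∸m]≡n V≤k ⟩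
  k                          ∎)
  where
  open ≡-Reasoning
  cyc-V : cyc n V ≡ V
  cyc-V = cyc-short n V (≤-trans (+-mono-≤ V≤k V≤k) lo)
  cyc-rest : cyc n (k ∸ V) ≡ k ∸ V
  cyc-rest = cyc-short n (k ∸ V) (≤-trans (+-mono-≤ (m∸n≤m k V) (m∸n≤m k V)) lo)
... | no V≰k = far k<V (trans (cong (_+ V) cyc-V) (m∸n+n≡m (<⇒≤ V<n))) (begin
  cyc n V + cyc n ∣ V - k ∣  ≡⟨ cong₂ _+_ cyc-V (trans (cong (cyc n) (m≤n⇒∣n-m∣≡n∸m (<⇒≤ k<V))) cyc-rest) ⟩
  (n ∸ V) + (V ∸ k)          ≡⟨ sym (+-∸-assoc (n ∸ V) (<⇒≤ k<V)) ⟩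
  ((n ∸ V) + V) ∸ k          ≡⟨ cong (_∸ k) (m∸n+n≡m (<⇒≤ V<n)) ⟩
  n ∸ k                      ∎)
  where
  open ≡-Reasoning
  k<V : k < V
  k<V = ≰⇒> V≰k
  cyc-V : cyc n V ≡ n ∸ V
  cyc-V = cyc-long n V (≤-trans hi (+-mono-≤ k<V (<⇒≤ k<V)))
  V∸k≤k : V ∸ k ≤ k
  V∸k≤k = m≤n+o⇒m∸n≤o V k (s≤s⁻¹ (≤-trans V<n hi))
  cyc-rest : cyc n (V ∸ k) ≡ V ∸ k
  cyc-rest = cyc-short n (V ∸ k) (≤-trans (+-mono-≤ V∸k≤k V∸k≤k) lo)

double-injective : ∀ p q → p + p ≡ q + q → p ≡ q
double-injective p q e = *-cancelˡ-≡ p q 2 (trans (double p) (trans e (sym (double q))))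

landmark-sum : ∀ p q c e c' e' → p + c ≡ q + c' → p + e ≡ q + e' → (p + p) + (c + e) ≡ (q + q) + (c' + e')
landmark-sum p q c e c' e' e₁ e₂ = trans (regroup p c e) (trans (cong₂ _+_ e₁ e₂) (sym (regroup q c' e')))
  where
  regroup : ∀ p c e → (p + p) + (c + e) ≡ (p + c) + (p + e)
  regroup = solve-∀

same-sum-same-layer : ∀ p q c e c' e' s → p + c ≡ q + c' → p + e ≡ q + e' → c + e ≡ s → c' + e' ≡ s →
                      p ≡ q × c ≡ c'
same-sum-same-layer p q c e c' e' s e₁ e₂ s₁ s₂ = p≡q , +-cancelˡ-≡ p c c' (trans e₁ (cong (_+ c') (sym p≡q)))
  where
  p≡q : p ≡ q
  p≡q = double-injective p q (+-cancelʳ-≡ s (p + p) (q + q)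
          (trans (cong ((p + p) +_) (sym s₁)) (trans (landmark-sum p q c e c' e' e₁ e₂) (cong ((q + q) +_) s₂))))

near-position : ∀ n V V' → cyc n V ≡ V → cyc n V' ≡ V' → cyc n V ≡ cyc n V' → V ≡ V'
near-position n V V' cyc-V cyc-V' same = trans (sym cyc-V) (trans same cyc-V')

far-position : ∀ n V V' → cyc n V + V ≡ n → cyc n V' + V' ≡ n → cyc n V ≡ cyc n V' → V ≡ V'
far-position n V V' cyc-V cyc-V' same =
  +-cancelˡ-≡ (cyc n V) V V' (trans cyc-V (trans (sym cyc-V') (cong (_+ V') (sym same))))

-- n = 2k + 1: the two landmark distances of (p , V) add up to 2p + k on the near
-- arc and to 2p + k + 1 beyond it, so their parity tells the arcs apart.
odd-arcs-clash : ∀ p q c e c' e' k → p + c ≡ q + c' → p + e ≡ q + e' → c + e ≡ k → c' + e' ≡ suc k → ⊥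
odd-arcs-clash p q c e c' e' k e₁ e₂ s s' = even≢odd′ p q (+-cancelʳ-≡ k (p + p) (suc (q + q)) (begin
  (p + p) + k          ≡⟨ cong ((p + p) +_) (sym s) ⟩
  (p + p) + (c + e)    ≡⟨ landmark-sum p q c e c' e' e₁ e₂ ⟩
  (q + q) + (c' + e')  ≡⟨ cong ((q + q) +_) s' ⟩
  (q + q) + suc k      ≡⟨ +-suc (q + q) k ⟩
  suc (q + q) + k      ∎))
  where open ≡-Reasoning

odd-determined : ∀ n k p q V V' → n ≡ suc (k + k) → V < n → V' < n →
                 p + cyc n V ≡ q + cyc n V' → p + cyc n ∣ V - k ∣ ≡ q + cyc n ∣ V' - k ∣ → p ≡ q × V ≡ V'
odd-determined n k p q V V' n≡ V<n V'<n e₀ eₖ = determined (arc-of V<n) (arc-of V'<n)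
  where
  arc-of : ∀ {X} → X < n → Arc n k X
  arc-of X<n = arc n k _ (subst (k + k ≤_) (sym n≡) (n≤1+n (k + k))) (≤-reflexive n≡) X<n
  n∸k≡1+k : n ∸ k ≡ suc k
  n∸k≡1+k = trans (cong (_∸ k) n≡) (m+n∸n≡m (suc k) k)
  determined : Arc n k V → Arc n k V' → p ≡ q × V ≡ V'
  determined (near cyc-V s) (near cyc-V' s') =
    let p≡q , same = same-sum-same-layer p q _ _ _ _ k e₀ eₖ s s'
    in p≡q , near-position n V V' cyc-V cyc-V' same
  determined (far _ cyc-V s) (far _ cyc-V' s') =
    let p≡q , same = same-sum-same-layer p q _ _ _ _ (n ∸ k) e₀ eₖ s s'
    in p≡q , far-position n V V' cyc-V cyc-V' same
  determined (near _ s) (far _ _ s') =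
    ⊥-elim (odd-arcs-clash p q _ _ _ _ k e₀ eₖ s (trans s' n∸k≡1+k))
  determined (far _ _ s) (near _ s') =
    ⊥-elim (odd-arcs-clash q p _ _ _ _ k (sym e₀) (sym eₖ) s' (trans s n∸k≡1+k))

-- n = k + k: a position V of the near arc and its reflection V' = n - V beyond k are
-- told apart by their cycle distances to 1 (these are V - 1 and V + 1).
reflection-separated : ∀ n k V V' → n ≡ k + k → k < V' → V' < n →
                       cyc n V ≡ V → cyc n V' + V' ≡ n → cyc n V ≡ cyc n V' →
                       cyc n ∣ V - 1 ∣ ≢ cyc n ∣ V' - 1 ∣
reflection-separated n k zero V' n≡2k k<V' V'<n cyc-V cyc-V' same _ =
  <-irrefl (trans (cong (_+ V') same) cyc-V') V'<n
reflection-separated n k (suc w) (suc w') n≡2k k<V' V'<n cyc-V cyc-V' same e =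
  <-irrefl (trans (sym cyc-w) (trans (cong (cyc n) (sym (∣-∣-identityʳ w))) (trans e cyc-w')))
           (n≤1+n (suc w))
  where
  n≡ : n ≡ suc (suc w) + w'
  n≡ = trans (sym (trans (cong (_+ suc w') (trans (sym cyc-V) same)) cyc-V')) (cong suc (+-suc w w'))
  n≤w'+w' : n ≤ w' + w'
  n≤w'+w' = ≤-trans (≤-reflexive n≡2k) (+-mono-≤ (s≤s⁻¹ k<V') (s≤s⁻¹ k<V'))
  2+w≤w' : suc (suc w) ≤ w'
  2+w≤w' = +-cancelʳ-≤ w' (suc (suc w)) w' (≤-trans (≤-reflexive (sym n≡)) n≤w'+w')
  cyc-w : cyc n w ≡ w
  cyc-w = cyc-short n w (≤-trans (+-mono-≤ (m≤n+m w 2) (≤-trans (m≤n+m w 2) 2+w≤w')) (≤-reflexive (sym n≡)))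
  cyc-w' : cyc n ∣ w' - 0 ∣ ≡ suc (suc w)
  cyc-w' = trans (cong (cyc n) (∣-∣-identityʳ w'))
    (trans (cyc-long n w' n≤w'+w') (trans (cong (_∸ w') n≡) (m+n∸n≡m (suc (suc w)) w')))

even-determined : ∀ n k p q V V' → n ≡ k + k → V < n → V' < n →
                  p + cyc n V ≡ q + cyc n V' → p + cyc n ∣ V - k ∣ ≡ q + cyc n ∣ V' - k ∣ →
                  p + cyc n ∣ V - 1 ∣ ≡ q + cyc n ∣ V' - 1 ∣ → p ≡ q × V ≡ V'
even-determined n k p q V V' n≡2k V<n V'<n e₀ eₖ e₁ = p≡q , position (arc-of V<n) (arc-of V'<n)
  where
  arc-of : ∀ {X} → X < n → Arc n k X
  arc-of X<n = arc n k _ (≤-reflexive (sym n≡2k)) (≤-trans (≤-reflexive n≡2k) (n≤1+n (k + k))) X<n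
  n∸k≡k : n ∸ k ≡ k
  n∸k≡k = trans (cong (_∸ k) n≡2k) (m+n∸n≡m k k)
  arc-sum : ∀ {X} → Arc n k X → cyc n X + cyc n ∣ X - k ∣ ≡ k
  arc-sum (near _ s) = s
  arc-sum (far _ _ s) = trans s n∸k≡k
  layer : p ≡ q × cyc n V ≡ cyc n V'
  layer = same-sum-same-layer p q _ _ _ _ k e₀ eₖ (arc-sum (arc-of V<n)) (arc-sum (arc-of V'<n))
  p≡q : p ≡ q
  p≡q = proj₁ layer
  same₀ : cyc n V ≡ cyc n V'
  same₀ = proj₂ layer
  same₁ : cyc n ∣ V - 1 ∣ ≡ cyc n ∣ V' - 1 ∣
  same₁ = +-cancelˡ-≡ p _ _ (trans e₁ (cong (_+ cyc n ∣ V' - 1 ∣) (sym p≡q)))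
  position : Arc n k V → Arc n k V' → V ≡ V'
  position (near cyc-V _) (near cyc-V' _) = near-position n V V' cyc-V cyc-V' same₀
  position (far _ cyc-V _) (far _ cyc-V' _) = far-position n V V' cyc-V cyc-V' same₀
  position (near cyc-V _) (far k<V' cyc-V' _) =
    ⊥-elim (reflection-separated n k V V' n≡2k k<V' V'<n cyc-V cyc-V' same₀ same₁)
  position (far k<V cyc-V _) (near cyc-V' _) =
    ⊥-elim (reflection-separated n k V' V n≡2k k<V V<n cyc-V' cyc-V (sym same₀) (sym same₁))

dist-to-layer0 : ∀ n p (v a : Fin n) A → toℕ a ≡ A → dist n (p , v) (0 , a) ≡ p + cyc n ∣ toℕ v - A ∣
dist-to-layer0 n p v a A refl = cong (_+ cdist n v a) (∣-∣-identityʳ p)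

landmark-equation : ∀ n p q (v v' a : Fin n) A → toℕ a ≡ A →
                    dist n (p , v) (0 , a) ≡ dist n (q , v') (0 , a) →
                    p + cyc n ∣ toℕ v - A ∣ ≡ q + cyc n ∣ toℕ v' - A ∣
landmark-equation n p q v v' a A a≡A e =
  trans (sym (dist-to-layer0 n p v a A a≡A)) (trans e (dist-to-layer0 n q v' a A a≡A))

origin-equation : ∀ n p q (v v' a : Fin n) → toℕ a ≡ 0 →
                  dist n (p , v) (0 , a) ≡ dist n (q , v') (0 , a) → p + cyc n (toℕ v) ≡ q + cyc n (toℕ v')
origin-equation n p q v v' a a≡0 e =
  subst₂ (λ d d' → p + cyc n d ≡ q + cyc n d') (∣-∣-identityʳ (toℕ v)) (∣-∣-identityʳ (toℕ v'))
         (landmark-equation n p q v v' a 0 a≡0 e)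

odd-resolving : ∀ n k (a b : Fin n) → n ≡ suc (k + k) → toℕ a ≡ 0 → toℕ b ≡ k →
                Resolving n ((0 , a) ∷ (0 , b) ∷ [])
odd-resolving n k a b n≡ a≡0 b≡k = resolving-by-distances n _ determined
  where
  determined : ∀ u w → All (λ x → dist n u x ≡ dist n w x) ((0 , a) ∷ (0 , b) ∷ []) → u ≡ w
  determined (p , v) (q , v') (e₀ ∷ eₖ ∷ [])
    with odd-determined n k p q (toℕ v) (toℕ v') n≡ (toℕ<n v) (toℕ<n v')
           (origin-equation n p q v v' a a≡0 e₀) (landmark-equation n p q v v' b k b≡k eₖ)
  ... | p≡q , v≡v' = cong₂ _,_ p≡q (toℕ-injective v≡v')

even-resolving : ∀ n k (a b c : Fin n) → n ≡ k + k → toℕ a ≡ 0 → toℕ b ≡ k → toℕ c ≡ 1 →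
                 Resolving n ((0 , a) ∷ (0 , b) ∷ (0 , c) ∷ [])
even-resolving n k a b c n≡2k a≡0 b≡k c≡1 = resolving-by-distances n _ determined
  where
  determined : ∀ u w → All (λ x → dist n u x ≡ dist n w x) ((0 , a) ∷ (0 , b) ∷ (0 , c) ∷ []) → u ≡ w
  determined (p , v) (q , v') (e₀ ∷ eₖ ∷ e₁ ∷ [])
    with even-determined n k p q (toℕ v) (toℕ v') n≡2k (toℕ<n v) (toℕ<n v')
           (origin-equation n p q v v' a a≡0 e₀) (landmark-equation n p q v v' b k b≡k eₖ)
           (landmark-equation n p q v v' c 1 c≡1 e₁)
  ... | p≡q , v≡v' = cong₂ _,_ p≡q (toℕ-injective v≡v')

layer0-distinct : ∀ {n} (a b : Fin n) {A B} → toℕ a ≡ A → toℕ b ≡ B → A ≢ B → _≢_ {A = V n} (0 , a) (0 , b)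
layer0-distinct a b a≡A b≡B A≢B e = A≢B (trans (sym a≡A) (trans (cong (toℕ ∘ proj₂) e) b≡B))

odd-half-positive : ∀ n k → 3 ≤ n → n ≡ suc (k + k) → 1 ≤ k
odd-half-positive n zero 3≤n n≡1 with subst (3 ≤_) n≡1 3≤n
... | s≤s ()
odd-half-positive n (suc k) _ _ = s≤s z≤n

even-half-≥2 : ∀ n k → 3 ≤ n → n ≡ k + k → 2 ≤ k
even-half-≥2 n zero 3≤n n≡0 with subst (3 ≤_) n≡0 3≤n
... | ()
even-half-≥2 n (suc zero) 3≤n n≡2 with subst (3 ≤_) n≡2 3≤n
... | s≤s (s≤s ())
even-half-≥2 n (suc (suc k)) _ _ = s≤s (s≤s z≤n)

odd-basis : ∀ n k → 3 ≤ n → n ≡ suc (k + k) → (a b : Fin n) → toℕ a ≡ 0 → toℕ b ≡ k →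
            IsMetricBasis n ((0 , a) ∷ (0 , b) ∷ [])
odd-basis n k 3≤n n≡ a b a≡0 b≡k =
  (layer0-distinct a b a≡0 b≡k (<⇒≢ (odd-half-positive n k 3≤n n≡)) ∷ []) AllPairs.∷ [] AllPairs.∷ AllPairs.[] ,
  odd-resolving n k a b n≡ a≡0 b≡k ,
  λ T _ → two-landmarks-needed n 3≤n T

even-basis : ∀ n k → 3 ≤ n → n ≡ k + k → (a b c : Fin n) → toℕ a ≡ 0 → toℕ b ≡ k → toℕ c ≡ 1 →
             IsMetricBasis n ((0 , a) ∷ (0 , b) ∷ (0 , c) ∷ [])
even-basis n k 3≤n n≡2k a b c a≡0 b≡k c≡1 =
  (a≢b ∷ layer0-distinct a c a≡0 c≡1 (λ ()) ∷ []) AllPairs.∷ (b≢c ∷ []) AllPairs.∷ [] AllPairs.∷ AllPairs.[] ,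
  even-resolving n k a b c n≡2k a≡0 b≡k c≡1 ,
  λ T _ → three-landmarks-needed n k n≡2k 3≤n T
  where
  2≤k : 2 ≤ k
  2≤k = even-half-≥2 n k 3≤n n≡2k
  a≢b : _≢_ {A = V n} (0 , a) (0 , b)
  a≢b = layer0-distinct a b a≡0 b≡k (<⇒≢ (≤-trans (n≤1+n 1) 2≤k))
  b≢c : _≢_ {A = V n} (0 , b) (0 , c)
  b≢c = layer0-distinct b c b≡k c≡1 (λ k≡1 → <⇒≢ 2≤k (sym k≡1))

halve-even : ∀ n → n % 2 ≡ 0 → n ≡ n / 2 + n / 2
halve-even n even = trans (m≡m%n+[m/n]*n n 2) (cong₂ _+_ even (trans (*-comm (n / 2) 2) (double (n / 2))))

halve-odd : ∀ n → n % 2 ≡ 1 → n ≡ suc ((n ∸ 1) / 2 + (n ∸ 1) / 2)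
halve-odd n odd = trans n≡ (cong (λ m → suc (m + m)) (sym half≡))
  where
  h : ℕ
  h = n / 2
  n≡ : n ≡ suc (h + h)
  n≡ = trans (m≡m%n+[m/n]*n n 2) (cong₂ _+_ odd (trans (*-comm h 2) (double h)))
  half≡ : (n ∸ 1) / 2 ≡ h
  half≡ = begin
    (n ∸ 1) / 2   ≡⟨ cong (λ m → (m ∸ 1) / 2) n≡ ⟩
    (h + h) / 2   ≡⟨ cong (_/ 2) (sym (trans (*-comm h 2) (double h))) ⟩
    (h * 2) / 2   ≡⟨ m*n/n≡m h 2 ⟩
    h             ∎
    where open ≡-Reasoning

vertex : ∀ {n} J → J < n → Σ (Fin n) λ j → toℕ j ≡ J
vertex J J<n = vertexAt (_≡ J) J<n refl

odd-case : ∀ n → 3 ≤ n → n % 2 ≡ 1 →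
  MetricDim n 2 ×
  (∀ (a b : Fin n) → toℕ a ≡ 0 → toℕ b ≡ (n ∸ 1) / 2 → IsMetricBasis n ((0 , a) ∷ (0 , b) ∷ []))
odd-case n 3≤n odd = (_ , basis (proj₁ origin) (proj₁ opposite) (proj₂ origin) (proj₂ opposite) , refl) , basis
  where
  k : ℕ
  k = (n ∸ 1) / 2
  n≡ : n ≡ suc (k + k)
  n≡ = halve-odd n odd
  basis : ∀ (a b : Fin n) → toℕ a ≡ 0 → toℕ b ≡ k → IsMetricBasis n ((0 , a) ∷ (0 , b) ∷ [])
  basis = odd-basis n k 3≤n n≡
  origin : Σ (Fin n) λ a → toℕ a ≡ 0
  origin = vertex 0 (≤-trans (s≤s z≤n) 3≤n)
  opposite : Σ (Fin n) λ b → toℕ b ≡ k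
  opposite = vertex k (subst (k <_) (sym n≡) (s≤s (m≤m+n k k)))

even-case : ∀ n → 3 ≤ n → n % 2 ≡ 0 →
  MetricDim n 3 ×
  (∀ (a b c : Fin n) → toℕ a ≡ 0 → toℕ b ≡ n / 2 → toℕ c ≡ 1 →
     IsMetricBasis n ((0 , a) ∷ (0 , b) ∷ (0 , c) ∷ []))
even-case n 3≤n even =
  (_ , basis (proj₁ origin) (proj₁ opposite) (proj₁ next) (proj₂ origin) (proj₂ opposite) (proj₂ next) , refl) ,
  basis
  where
  k : ℕ
  k = n / 2
  n≡2k : n ≡ k + k
  n≡2k = halve-even n even
  basis : ∀ (a b c : Fin n) → toℕ a ≡ 0 → toℕ b ≡ k → toℕ c ≡ 1 →
          IsMetricBasis n ((0 , a) ∷ (0 , b) ∷ (0 , c) ∷ [])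
  basis = even-basis n k 3≤n n≡2k
  origin : Σ (Fin n) λ a → toℕ a ≡ 0
  origin = vertex 0 (≤-trans (s≤s z≤n) 3≤n)
  opposite : Σ (Fin n) λ b → toℕ b ≡ k
  opposite = vertex k (subst (k <_) (sym n≡2k) (m<m+n k (≤-trans (s≤s z≤n) (even-half-≥2 n k 3≤n n≡2k))))
  next : Σ (Fin n) λ c → toℕ c ≡ 1
  next = vertex 1 (≤-trans (s≤s (s≤s z≤n)) 3≤n)

proposition6 : ∀ (n : ℕ) → 3 ≤ n →
    (n % 2 ≡ 1 →
      MetricDim n 2 ×
      (∀ (a b : Fin n) → toℕ a ≡ 0 → toℕ b ≡ (n ∸ 1) / 2 →
        IsMetricBasis n ((0 , a) ∷ (0 , b) ∷ [])))
    ×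
    (n % 2 ≡ 0 →
      MetricDim n 3 ×
      (∀ (a b c : Fin n) → toℕ a ≡ 0 → toℕ b ≡ n / 2 → toℕ c ≡ 1 →
        IsMetricBasis n ((0 , a) ∷ (0 , b) ∷ (0 , c) ∷ [])))
proposition6 n 3≤n = odd-case n 3≤n , even-case n 3≤n
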